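{- For every integer $m\ge3$ there exists a polyomino with $n=2m$ tiles that admits exactly one set of $m$ non-attacking rooks.
   Context: A polyomino is a finite union of unit squares (tiles) of the standard grid in $\mathbb{R}^2$ with connected interior. Two tiles of $P$ are in the same row (resp. column) of $P$ if the segment joining their centers is horizontal (resp. vertical) and contained in $P$. A set of rooks on distinct tiles is non-attacking if no two are in the same row or column of $P$. -}

module Defs where

open import Data.Nat using (ℕ)
open import Data.Integer as ℤ using (ℤ; _≤_; +_)
open import Data.Product using (_×_; _,_; proj₁; proj₂; Σ)
open import Data.Sum using (_⊎_)
open import Data.List using (List; length; _∷_)
open import Data.List.Membership.Propositional using (_∈_)
open import Data.List.Relation.Unary.Unique.Propositional using (Unique)
open import Relation.Binary.PropositionalEquality using (_≡_; _≢_)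
open import Relation.Nullary using (¬_)

-- A tile is the unit square [x, x+1] × [y, y+1], identified by (x , y).
Cell : Set
Cell = ℤ × ℤ

Adjacent : Cell → Cell → Set
Adjacent (x , y) (x' , y') =
  (y ≡ y' × (x' ≡ x ℤ.+ + 1 ⊎ x ≡ x' ℤ.+ + 1)) ⊎
  (x ≡ x' × (y' ≡ y ℤ.+ + 1 ⊎ y ≡ y' ℤ.+ + 1))

data Path (T : List Cell) : Cell → Cell → Set where
  here : ∀ {a} → a ∈ T → Path T a a
  step : ∀ {a b c} → a ∈ T → Adjacent a b → Path T b c → Path T a c

-- A polyomino: finitely many distinct tiles whose union has connected
-- interior (equivalently: the tiles are connected via shared edges).
record Polyomino : Set where
  field
    tiles     : List Cell
    distinct  : Unique tiles
    connected : ∀ {a b} → a ∈ tiles → b ∈ tiles → Path tiles a b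

open Polyomino public

Between : ℤ → ℤ → ℤ → Set
Between a b x = (a ≤ x × x ≤ b) ⊎ (b ≤ x × x ≤ a)

-- Same row: the horizontal segment joining the centres lies in P,
-- i.e. every tile between them in that horizontal line is a tile of P.
SameRow : Polyomino → Cell → Cell → Set
SameRow P (x , y) (x' , y') =
  y ≡ y' × (∀ z → Between x x' z → (z , y) ∈ tiles P)

SameCol : Polyomino → Cell → Cell → Set
SameCol P (x , y) (x' , y') =
  x ≡ x' × (∀ z → Between y y' z → (x , z) ∈ tiles P)

NonAttacking : Polyomino → List Cell → Set
NonAttacking P R =
  Unique R ×
  (∀ {a} → a ∈ R → a ∈ tiles P) ×
  (∀ {a b} → a ∈ R → b ∈ R → a ≢ b → ¬ SameRow P a b × ¬ SameCol P a b)

RookSet : Polyomino → ℕ → List Cell → Set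
RookSet P m R = NonAttacking P R × length R ≡ m

SameSet : List Cell → List Cell → Set
SameSet R S = ∀ c → (c ∈ R → c ∈ S) × (c ∈ S → c ∈ R)

UniqueRookSet : Polyomino → ℕ → Set
UniqueRookSet P m =
  Σ (List Cell) λ R → RookSet P m R × (∀ S → RookSet P m S → SameSet S R)

-- With n = m − 1, take the staircase of the diagonal tiles (i, i), 0 ≤ i ≤ n, and
-- the subdiagonal tiles (i + 1, i), together with one extra tile (2, 0); it has 2m
-- tiles and is row- and column-convex, so non-attacking rooks lie in distinct rows
-- and columns. With n + 1 rooks every column 0, …, n carries one, and by induction
-- on the column the rook of column x is (x, x): any lower tile of column x lies in
-- the row of a diagonal tile (y, y) with y < x, which already holds a rook.

module Submission where

open import Defs
open import Data.Nat using (ℕ; zero; suc; _+_; _*_; _≤_; _<_; _⊓_; _⊔_; z≤n; s≤s; s≤s⁻¹)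
open import Data.Nat.Properties
  using (≤-refl; ≤-trans; ≤-antisym; <⇒≤; n≤1+n; 1+n≰n; m≤n⇒m<n∨m≡n; <-irrefl;
         +-comm; +-suc; +-identityʳ; m⊓n≤m; m⊓n≤n; m≤m⊔n; m≤n⊔m; ⊓-glb; ⊔-lub)
open import Data.Nat.Induction using (<-rec)
open import Data.Integer as ℤ using (+_; +≤+; ∣_∣)
open import Data.Integer.Properties using (+-injective)
open import Data.Fin as Fin using (Fin; toℕ; fromℕ<; punchOut)
open import Data.Fin.Properties using (punchOut-injective; injective⇒≤; toℕ-fromℕ<; any?)
open import Data.List using (List; _∷_; _++_; applyUpTo; length; lookup)
open import Data.List.Properties using (length-++; length-applyUpTo)
open import Data.List.Membership.Propositional using (_∈_)
open import Data.List.Membership.Propositional.Properties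
  using (∈-lookup; ∈-++⁺ˡ; ∈-++⁺ʳ; ∈-++⁻; ∈-applyUpTo⁺; ∈-applyUpTo⁻)
open import Data.List.Relation.Unary.Any using (here; there)
import Data.List.Relation.Unary.All as All
open import Data.List.Relation.Unary.AllPairs using (_∷_)
open import Data.List.Relation.Unary.Unique.Propositional using (Unique)
import Data.List.Relation.Unary.Unique.Propositional.Properties as Unique
open import Data.Product using (Σ; ∃; ∃₂; _×_; _,_; proj₁; proj₂)
open import Data.Sum using (inj₁; inj₂)
open import Function using (_∘_)
open import Function.Definitions using (Injective)
open import Relation.Nullary using (¬_; yes; no; contradiction)
open import Relation.Binary.PropositionalEquality
  using (_≡_; _≢_; refl; sym; trans; cong; cong₂; subst; module ≡-Reasoning)

injective⇒surjective : ∀ {n} {f : Fin n → Fin n} → Injective _≡_ _≡_ f →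
                       ∀ j → ∃ λ i → f i ≡ j
injective⇒surjective {suc n} {f} f-injective j with any? (λ i → f i Fin.≟ j)
... | yes hit = hit
... | no miss = contradiction (injective⇒≤ g-injective) 1+n≰n
  where
  -- Missing j, f would inject Fin (suc n) into the n values other than j.
  j≢f : ∀ i → j ≢ f i
  j≢f i j≡fi = miss (i , sym j≡fi)

  g : Fin (suc n) → Fin n
  g i = punchOut (j≢f i)

  g-injective : Injective _≡_ _≡_ g
  g-injective {i} {i'} = f-injective ∘ punchOut-injective (j≢f i) (j≢f i')

module _ {A : Set} where

  Unique⇒lookup-injective : ∀ {xs : List A} → Unique xs →
                            ∀ i j → lookup xs i ≡ lookup xs j → i ≡ j
  Unique⇒lookup-injective (_ ∷ _) Fin.zero Fin.zero _ = refl
  Unique⇒lookup-injective (x∉ ∷ _) Fin.zero (Fin.suc j) eq = contradiction eq (All.lookup x∉ (∈-lookup j))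
  Unique⇒lookup-injective (x∉ ∷ _) (Fin.suc i) Fin.zero eq = contradiction (sym eq) (All.lookup x∉ (∈-lookup i))
  Unique⇒lookup-injective (_ ∷ u) (Fin.suc i) (Fin.suc j) eq = cong Fin.suc (Unique⇒lookup-injective u i j eq)

  injectiveOn⇒onto : ∀ {xs : List A} (f : A → ℕ) → Unique xs →
                     (∀ {a b} → a ∈ xs → b ∈ xs → f a ≡ f b → a ≡ b) →
                     (∀ {a} → a ∈ xs → f a < length xs) →
                     ∀ {j} → j < length xs → ∃ λ a → a ∈ xs × f a ≡ j
  injectiveOn⇒onto {xs} f unique f-injective f< {j} j< = lookup xs i , ∈-lookup i , f-lookup-i≡j
    where
    g : Fin (length xs) → Fin (length xs)
    g i = fromℕ< (f< (∈-lookup i))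

    toℕ-g : ∀ i → toℕ (g i) ≡ f (lookup xs i)
    toℕ-g i = toℕ-fromℕ< (f< (∈-lookup i))

    g-injective : Injective _≡_ _≡_ g
    g-injective {i} {i'} gi≡gi' =
      Unique⇒lookup-injective unique i i'
        (f-injective (∈-lookup i) (∈-lookup i')
          (trans (sym (toℕ-g i)) (trans (cong toℕ gi≡gi') (toℕ-g i'))))

    hit : ∃ λ i → g i ≡ fromℕ< j<
    hit = injective⇒surjective g-injective (fromℕ< j<)

    i : Fin (length xs)
    i = proj₁ hit

    f-lookup-i≡j : f (lookup xs i) ≡ j
    f-lookup-i≡j = begin
      f (lookup xs i)  ≡⟨ sym (toℕ-g i) ⟩
      toℕ (g i)        ≡⟨ cong toℕ (proj₂ hit) ⟩
      toℕ (fromℕ< j<)  ≡⟨ toℕ-fromℕ< j< ⟩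
      j                ∎
      where open ≡-Reasoning

reverseₚ : ∀ {T a b} → Path T a b → Path T b a
reverseₚ p = go p (here (start p))
  where
  start : ∀ {T a b} → Path T a b → a ∈ T
  start (here a∈) = a∈
  start (step a∈ _ _) = a∈

  flip-adjacent : ∀ {a b} → Adjacent a b → Adjacent b a
  flip-adjacent (inj₁ (eq , inj₁ p)) = inj₁ (sym eq , inj₂ p)
  flip-adjacent (inj₁ (eq , inj₂ p)) = inj₁ (sym eq , inj₁ p)
  flip-adjacent (inj₂ (eq , inj₁ p)) = inj₂ (sym eq , inj₂ p)
  flip-adjacent (inj₂ (eq , inj₂ p)) = inj₂ (sym eq , inj₁ p)

  go : ∀ {T a b c} → Path T a b → Path T a c → Path T b c
  go (here _) acc = acc
  go (step _ a~b p) acc = go p (step (start p) (flip-adjacent a~b) acc)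

_++ₚ_ : ∀ {T a b c} → Path T a b → Path T b c → Path T a c
here _ ++ₚ q = q
step a∈ a~b p ++ₚ q = step a∈ a~b (p ++ₚ q)

pt : ℕ → ℕ → Cell
pt x y = (+ x , + y)

+suc≡+1 : ∀ k → + suc k ≡ + k ℤ.+ + 1
+suc≡+1 k = cong +_ (+-comm 1 k)

left-adjacent : ∀ {x y} → Adjacent (pt (suc x) y) (pt x y)
left-adjacent {x} = inj₁ (refl , inj₂ (+suc≡+1 x))

down-adjacent : ∀ {x y} → Adjacent (pt x (suc y)) (pt x y)
down-adjacent {_} {y} = inj₂ (refl , inj₂ (+suc≡+1 y))

Between⇒⊓⊔ : ∀ {p q z} → Between (+ p) (+ q) z →
             ∃ λ r → z ≡ + r × p ⊓ q ≤ r × r ≤ p ⊔ q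
Between⇒⊓⊔ {p} {q} (inj₁ (+≤+ p≤r , +≤+ r≤q)) =
  _ , refl , ≤-trans (m⊓n≤m p q) p≤r , ≤-trans r≤q (m≤n⊔m p q)
Between⇒⊓⊔ {p} {q} (inj₂ (+≤+ q≤r , +≤+ r≤p)) =
  _ , refl , ≤-trans (m⊓n≤n p q) q≤r , ≤-trans r≤p (m≤m⊔n p q)

module _ (P : Polyomino) where

  sameRow⁺ : ∀ {x x' y} → (∀ {r} → x ⊓ x' ≤ r → r ≤ x ⊔ x' → pt r y ∈ tiles P) →
             SameRow P (pt x y) (pt x' y)
  sameRow⁺ {x} {x'} {y} fill = refl , inRow
    where
    inRow : ∀ z → Between (+ x) (+ x') z → (z , + y) ∈ tiles P
    inRow z between with Between⇒⊓⊔ between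
    ... | _ , refl , lower , upper = fill lower upper

  sameCol⁺ : ∀ {x y y'} → (∀ {r} → y ⊓ y' ≤ r → r ≤ y ⊔ y' → pt x r ∈ tiles P) →
             SameCol P (pt x y) (pt x y')
  sameCol⁺ {x} {y} {y'} fill = refl , inColumn
    where
    inColumn : ∀ z → Between (+ y) (+ y') z → (+ x , z) ∈ tiles P
    inColumn z between with Between⇒⊓⊔ between
    ... | _ , refl , lower , upper = fill lower upper

  RowConvex : Set
  RowConvex = ∀ {x x' y} → (x , y) ∈ tiles P → (x' , y) ∈ tiles P → SameRow P (x , y) (x' , y)

  ColumnConvex : Set
  ColumnConvex = ∀ {x y y'} → (x , y) ∈ tiles P → (x , y') ∈ tiles P → SameCol P (x , y) (x , y')

  row-has-one-rook : RowConvex → ∀ {R} → NonAttacking P R →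
                     ∀ {x x' y} → (x , y) ∈ R → (x' , y) ∈ R → x ≡ x'
  row-has-one-rook convex (_ , R⊆P , safe) {x} {x'} a∈ b∈ with x ℤ.≟ x'
  ... | yes x≡x' = x≡x'
  ... | no x≢x' = contradiction (convex (R⊆P a∈) (R⊆P b∈)) (proj₁ (safe a∈ b∈ (x≢x' ∘ cong proj₁)))

  column-has-one-rook : ColumnConvex → ∀ {R} → NonAttacking P R →
                        ∀ {x y y'} → (x , y) ∈ R → (x , y') ∈ R → y ≡ y'
  column-has-one-rook convex (_ , R⊆P , safe) {_} {y} {y'} a∈ b∈ with y ℤ.≟ y'
  ... | yes y≡y' = y≡y'
  ... | no y≢y' = contradiction (convex (R⊆P a∈) (R⊆P b∈)) (proj₂ (safe a∈ b∈ (y≢y' ∘ cong proj₂)))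

-- Column x of the staircase is the interval [columnStart x, x], and row y is
-- [y, rowEnd y] cut off at n.
columnStart : ℕ → ℕ
columnStart (suc (suc (suc k))) = suc (suc k)
columnStart _ = 0

columnStart-suc≤ : ∀ i → columnStart (suc i) ≤ i
columnStart-suc≤ zero = z≤n
columnStart-suc≤ (suc zero) = z≤n
columnStart-suc≤ (suc (suc i)) = ≤-refl

rowEnd : ℕ → ℕ
rowEnd zero = 2
rowEnd (suc y) = suc (suc y)

suc≤rowEnd : ∀ y → suc y ≤ rowEnd y
suc≤rowEnd zero = s≤s z≤n
suc≤rowEnd (suc y) = ≤-refl

module Staircase (n : ℕ) where

  data Tile : ℕ → ℕ → Set where
    diagonal    : ∀ {i} → i ≤ n → Tile i i
    subdiagonal : ∀ {i} → suc i ≤ n → Tile (suc i) i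
    corner      : 2 ≤ n → Tile 2 0

  diagonalCell subdiagonalCell : ℕ → Cell
  diagonalCell i = pt i i
  subdiagonalCell i = pt (suc i) i

  diagonalCells : List Cell
  diagonalCells = applyUpTo diagonalCell (suc n)

  subdiagonalCells : List Cell
  subdiagonalCells = applyUpTo subdiagonalCell n

  tileList : List Cell
  tileList = pt 2 0 ∷ diagonalCells ++ subdiagonalCells

  ∈-diagonalCells⁺ : ∀ {i} → i ≤ n → pt i i ∈ diagonalCells
  ∈-diagonalCells⁺ i≤n = ∈-applyUpTo⁺ diagonalCell (s≤s i≤n)

  ∈-diagonalCells⁻ : ∀ {c} → c ∈ diagonalCells → ∃ λ i → i ≤ n × c ≡ pt i i
  ∈-diagonalCells⁻ c∈ with ∈-applyUpTo⁻ diagonalCell c∈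
  ... | i , i<1+n , c≡ = i , s≤s⁻¹ i<1+n , c≡

  diagonalCells-unique : Unique diagonalCells
  diagonalCells-unique = Unique.applyUpTo⁺₁ diagonalCell (suc n) λ i<j _ → λ { refl → <-irrefl refl i<j }

  diagonalCells-length : length diagonalCells ≡ suc n
  diagonalCells-length = length-applyUpTo diagonalCell (suc n)

  ∈-tileList⁺ : ∀ {x y} → Tile x y → pt x y ∈ tileList
  ∈-tileList⁺ (diagonal i≤n) = there (∈-++⁺ˡ (∈-diagonalCells⁺ i≤n))
  ∈-tileList⁺ (subdiagonal i<n) = there (∈-++⁺ʳ _ (∈-applyUpTo⁺ subdiagonalCell i<n))
  ∈-tileList⁺ (corner _) = here refl

  ∈-tileList⁻ : 2 ≤ n → ∀ {c} → c ∈ tileList → ∃₂ λ x y → c ≡ pt x y × Tile x y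
  ∈-tileList⁻ 2≤n (here refl) = _ , _ , refl , corner 2≤n
  ∈-tileList⁻ _ (there c∈) with ∈-++⁻ diagonalCells c∈
  ... | inj₁ c∈diagonal with ∈-diagonalCells⁻ c∈diagonal
  ...   | _ , i≤n , refl = _ , _ , refl , diagonal i≤n
  ∈-tileList⁻ _ (there c∈) | inj₂ c∈subdiagonal with ∈-applyUpTo⁻ subdiagonalCell c∈subdiagonal
  ...   | _ , i<n , refl = _ , _ , refl , subdiagonal i<n

  tileList-unique : Unique tileList
  tileList-unique =
    All.tabulate corner-fresh ∷ Unique.++⁺ diagonalCells-unique subdiagonalCells-unique disjoint
    where
    subdiagonalCells-unique : Unique subdiagonalCells
    subdiagonalCells-unique = Unique.applyUpTo⁺₁ subdiagonalCell n λ i<j _ → λ { refl → <-irrefl refl i<j }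

    disjoint : ∀ {c} → ¬ (c ∈ diagonalCells × c ∈ subdiagonalCells)
    disjoint (c∈diagonal , c∈subdiagonal) with ∈-diagonalCells⁻ c∈diagonal | ∈-applyUpTo⁻ subdiagonalCell c∈subdiagonal
    ... | _ , _ , refl | _ , _ , ()

    corner-fresh : ∀ {c} → c ∈ diagonalCells ++ subdiagonalCells → pt 2 0 ≢ c
    corner-fresh c∈ with ∈-++⁻ diagonalCells c∈
    ... | inj₁ c∈diagonal with ∈-diagonalCells⁻ c∈diagonal
    ...   | _ , _ , refl = λ ()
    corner-fresh c∈ | inj₂ c∈subdiagonal with ∈-applyUpTo⁻ subdiagonalCell c∈subdiagonal
    ...   | _ , _ , refl = λ ()

  tileList-length : length tileList ≡ 2 * suc n
  tileList-length = begin
    suc (length (diagonalCells ++ subdiagonalCells))      ≡⟨ cong suc (length-++ diagonalCells) ⟩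
    suc (length diagonalCells + length subdiagonalCells)  ≡⟨ cong suc (cong₂ _+_ diagonalCells-length (length-applyUpTo subdiagonalCell n)) ⟩
    suc (suc n + n)                                       ≡⟨ cong (λ k → suc (suc n + k)) (sym (+-identityʳ n)) ⟩
    suc (suc (n + (n + 0)))                               ≡⟨ cong suc (sym (+-suc n (n + 0))) ⟩
    2 * suc n                                             ∎
    where open ≡-Reasoning

  Tile⇒column : ∀ {x y} → Tile x y → x ≤ n × columnStart x ≤ y × y ≤ x
  Tile⇒column (diagonal {zero} 0≤n) = 0≤n , z≤n , z≤n
  Tile⇒column (diagonal {suc i} i<n) = i<n , ≤-trans (columnStart-suc≤ i) (n≤1+n i) , ≤-refl
  Tile⇒column (subdiagonal {i} i<n) = i<n , columnStart-suc≤ i , n≤1+n i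
  Tile⇒column (corner 2≤n) = 2≤n , z≤n , z≤n

  column⇒Tile : ∀ {x y} → x ≤ n → columnStart x ≤ y → y ≤ x → Tile x y
  column⇒Tile x≤n start≤y y≤x with m≤n⇒m<n∨m≡n y≤x
  ... | inj₂ refl = diagonal x≤n
  ... | inj₁ y<x = below x≤n start≤y y<x
    where
    below : ∀ {x y} → x ≤ n → columnStart x ≤ y → y < x → Tile x y
    below {1} {0} 1≤n _ _ = subdiagonal 1≤n
    below {2} {0} 2≤n _ _ = corner 2≤n
    below {2} {1} 2≤n _ _ = subdiagonal 2≤n
    below {1} {suc _} _ _ (s≤s ())
    below {2} {suc (suc _)} _ _ (s≤s (s≤s ()))
    below {suc (suc (suc k))} x≤n start≤y (s≤s y≤) with ≤-antisym y≤ start≤y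
    ... | refl = subdiagonal x≤n

  Tile⇒row : ∀ {x y} → Tile x y → x ≤ n × y ≤ x × x ≤ rowEnd y
  Tile⇒row (diagonal {i} i≤n) = i≤n , ≤-refl , ≤-trans (n≤1+n i) (suc≤rowEnd i)
  Tile⇒row (subdiagonal {i} i<n) = i<n , n≤1+n i , suc≤rowEnd i
  Tile⇒row (corner 2≤n) = 2≤n , z≤n , ≤-refl

  row⇒Tile : ∀ {x y} → x ≤ n → y ≤ x → x ≤ rowEnd y → Tile x y
  row⇒Tile x≤n y≤x x≤end with m≤n⇒m<n∨m≡n y≤x
  ... | inj₂ refl = diagonal x≤n
  ... | inj₁ y<x = right x≤n y<x x≤end
    where
    right : ∀ {x y} → x ≤ n → y < x → x ≤ rowEnd y → Tile x y
    right {1} {0} 1≤n _ _ = subdiagonal 1≤n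
    right {2} {0} 2≤n _ _ = corner 2≤n
    right {suc (suc (suc _))} {0} _ _ (s≤s (s≤s ()))
    right {suc x} {suc y} x≤n (s≤s y<x) x≤end with ≤-antisym (s≤s⁻¹ x≤end) y<x
    ... | refl = subdiagonal x≤n

  mutual
    diagonal⇝origin : ∀ {i} → i ≤ n → Path tileList (pt i i) (pt 0 0)
    diagonal⇝origin {zero} 0≤n = here (∈-tileList⁺ (diagonal 0≤n))
    diagonal⇝origin {suc i} i<n = step (∈-tileList⁺ (diagonal i<n)) down-adjacent (subdiagonal⇝origin i<n)

    subdiagonal⇝origin : ∀ {i} → suc i ≤ n → Path tileList (pt (suc i) i) (pt 0 0)
    subdiagonal⇝origin i<n = step (∈-tileList⁺ (subdiagonal i<n)) left-adjacent (diagonal⇝origin (<⇒≤ i<n))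

  Tile⇝origin : ∀ {x y} → Tile x y → Path tileList (pt x y) (pt 0 0)
  Tile⇝origin (diagonal i≤n) = diagonal⇝origin i≤n
  Tile⇝origin (subdiagonal i<n) = subdiagonal⇝origin i<n
  Tile⇝origin (corner 2≤n) = step (∈-tileList⁺ (corner 2≤n)) left-adjacent (subdiagonal⇝origin (<⇒≤ 2≤n))

  module _ (2≤n : 2 ≤ n) where

    staircase : Polyomino
    staircase = record
      { tiles = tileList
      ; distinct = tileList-unique
      ; connected = λ a∈ b∈ → ⇝origin a∈ ++ₚ reverseₚ (⇝origin b∈)
      }
      where
      ⇝origin : ∀ {c} → c ∈ tileList → Path tileList c (pt 0 0)
      ⇝origin c∈ with ∈-tileList⁻ 2≤n c∈
      ... | _ , _ , refl , tile = Tile⇝origin tile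

    staircase-rowConvex : RowConvex staircase
    staircase-rowConvex a∈ b∈ with ∈-tileList⁻ 2≤n a∈ | ∈-tileList⁻ 2≤n b∈
    ... | _ , _ , refl , a | _ , _ , refl , b with Tile⇒row a | Tile⇒row b
    ... | x≤n , y≤x , x≤end | x'≤n , y≤x' , x'≤end =
      sameRow⁺ staircase λ lower upper → ∈-tileList⁺ (row⇒Tile
        (≤-trans upper (⊔-lub x≤n x'≤n)) (≤-trans (⊓-glb y≤x y≤x') lower) (≤-trans upper (⊔-lub x≤end x'≤end)))

    staircase-columnConvex : ColumnConvex staircase
    staircase-columnConvex a∈ b∈ with ∈-tileList⁻ 2≤n a∈ | ∈-tileList⁻ 2≤n b∈
    ... | _ , _ , refl , a | _ , _ , refl , b with Tile⇒column a | Tile⇒column b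
    ... | x≤n , start≤y , y≤x | _ , start≤y' , y'≤x =
      sameCol⁺ staircase λ lower upper → ∈-tileList⁺ (column⇒Tile
        x≤n (≤-trans (⊓-glb start≤y start≤y') lower) (≤-trans upper (⊔-lub y≤x y'≤x)))

    diagonalCells-rookSet : RookSet staircase (suc n) diagonalCells
    diagonalCells-rookSet =
      (diagonalCells-unique , there ∘ ∈-++⁺ˡ , not-attacking) , diagonalCells-length
      where
      not-attacking : ∀ {a b} → a ∈ diagonalCells → b ∈ diagonalCells → a ≢ b →
                      ¬ SameRow staircase a b × ¬ SameCol staircase a b
      not-attacking a∈ b∈ a≢b with ∈-diagonalCells⁻ a∈ | ∈-diagonalCells⁻ b∈
      ... | i , _ , refl | j , _ , refl = (+i≢+j ∘ proj₁) , (+i≢+j ∘ proj₁)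
        where
        +i≢+j : + i ≢ + j
        +i≢+j = a≢b ∘ cong (λ z → z , z)

    module _ {S : List Cell} (nonAttacking : NonAttacking staircase S) (S-length : length S ≡ suc n) where

      rook⇒Tile : ∀ {c} → c ∈ S → ∃₂ λ x y → c ≡ pt x y × Tile x y
      rook⇒Tile c∈ = ∈-tileList⁻ 2≤n (proj₁ (proj₂ nonAttacking) c∈)

      column : Cell → ℕ
      column c = ∣ proj₁ c ∣

      column-injective : ∀ {a b} → a ∈ S → b ∈ S → column a ≡ column b → a ≡ b
      column-injective a∈ b∈ x≡x' with rook⇒Tile a∈ | rook⇒Tile b∈
      ... | x , _ , refl , _ | _ , _ , refl , _ with x≡x'
      ... | refl = cong (+ x ,_) (column-has-one-rook staircase staircase-columnConvex nonAttacking a∈ b∈)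

      column<length : ∀ {c} → c ∈ S → column c < length S
      column<length c∈ with rook⇒Tile c∈
      ... | _ , _ , refl , tile = subst (_ <_) (sym S-length) (s≤s (proj₁ (Tile⇒row tile)))

      column-occupied : ∀ {x} → x ≤ n → ∃ λ y → pt x y ∈ S × Tile x y
      column-occupied x≤n
        with injectiveOn⇒onto column (proj₁ nonAttacking) column-injective column<length
               (subst (_ <_) (sym S-length) (s≤s x≤n))
      ... | c , c∈ , column≡x with rook⇒Tile c∈
      ... | _ , y , refl , tile with column≡x
      ... | refl = y , c∈ , tile

      diagonal-occupied : ∀ x → x ≤ n → pt x x ∈ S
      diagonal-occupied = <-rec _ occupied
        where
        occupied : ∀ x → (∀ {y} → y < x → y ≤ n → pt y y ∈ S) → x ≤ n → pt x x ∈ S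
        occupied x below x≤n with column-occupied x≤n
        ... | y , xy∈ , tile with m≤n⇒m<n∨m≡n (proj₁ (proj₂ (Tile⇒row tile)))
        ... | inj₂ refl = xy∈
        ... | inj₁ y<x = contradiction y<x (<-irrefl (sym (+-injective
              (row-has-one-rook staircase staircase-rowConvex nonAttacking xy∈ (below y<x (≤-trans (<⇒≤ y<x) x≤n))))))

      rooks-on-diagonal : SameSet S diagonalCells
      rooks-on-diagonal c = on-diagonal , occupied
        where
        on-diagonal : c ∈ S → c ∈ diagonalCells
        on-diagonal c∈ with rook⇒Tile c∈
        ... | x , y , refl , tile with proj₁ (Tile⇒row tile)
        ... | x≤n with column-has-one-rook staircase staircase-columnConvex nonAttacking c∈ (diagonal-occupied x x≤n)
        ... | refl = ∈-diagonalCells⁺ x≤n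

        occupied : c ∈ diagonalCells → c ∈ S
        occupied c∈ with ∈-diagonalCells⁻ c∈
        ... | i , i≤n , refl = diagonal-occupied i i≤n

theorem20 : (m : ℕ) → 3 ≤ m →
    Σ Polyomino λ P → length (tiles P) ≡ 2 * m × UniqueRookSet P m
theorem20 (suc n) (s≤s 2≤n) =
  staircase 2≤n , tileList-length , diagonalCells , diagonalCells-rookSet 2≤n ,
  λ S (nonAttacking , S-length) → rooks-on-diagonal 2≤n nonAttacking S-length
  where open Staircase n
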